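{- The following rational functions, regarded as power series in $q$, all belong to $\mathscr{X}$: (xii) $t\frac{1+q^2}{1-q^2}+\frac{q}{1-q^2}$ for every $t\in\mathbb{C}\setminus\{0\}$; (xiii) $\frac{q^2+7q+1}{6q^2+6q+6}$; (xiii') $\frac{ -q^2+7q-1}{6q^2-6q+6}$; (xiv) $\frac{q^2+10q+1}{12(q-1)^2}$; (xiv') $\frac{ -q^2+10q-1}{12(q+1)^2}$.
   Context: A power series $f(q)\in\mathbb{C}[[q]]$ is normalized multiplicative if $f(q)=\frac{1}{2a_0}+\sum_{n\ge1}a_nq^n$ with $a_0\in\mathbb{C}\setminus\{0\}$, $a_1=1$, and $a_{mn}=a_ma_n$ whenever $m,n\ge1$ are relatively prime; $f$ is multiplicative if $\lambda f$ is normalized multiplicative for some $\lambda\in\mathbb{C}$. $\mathscr{X}$ denotes the set of normalized multiplicative $f$ such that $f^2$ is multiplicative. -}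

module Defs where

open import Level using (Level; _⊔_) renaming (suc to lsuc)
open import Algebra.Bundles using (CommutativeRing)
open import Data.Nat as ℕ using (ℕ; zero; suc; _∸_; _≥_)
open import Data.Nat.Coprimality using (Coprime)
open import Data.List using (List; []; _∷_)
open import Data.Product using (Σ; _×_)
open import Relation.Nullary using (¬_)

module _ {c ℓ} (R : CommutativeRing c ℓ) where
  open CommutativeRing R using (Carrier; _+_; 0#; 1#)
  ιℕ : ℕ → Carrier
  ιℕ zero = 0#
  ιℕ (suc n) = 1# + ιℕ n

-- A field of characteristic zero (stand-in for ℂ, which agda-stdlib lacks).
record CharZeroField (c ℓ : Level) : Set (lsuc (c ⊔ ℓ)) where
  field
    commutativeRing : CommutativeRing c ℓ
  open CommutativeRing commutativeRing using (Carrier; _≈_; _*_; 0#; 1#)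
  field
    inverse  : ∀ x → ¬ (x ≈ 0#) → Σ Carrier (λ y → x * y ≈ 1#)
    charZero : ∀ n → ¬ (ιℕ commutativeRing (suc n) ≈ 0#)
  open CommutativeRing commutativeRing public
    using (Carrier; _≈_; _+_; _*_; -_; 0#; 1#)

module PowerSeries {c ℓ} (F : CharZeroField c ℓ) where
  open CharZeroField F

  Series : Set c
  Series = ℕ → Carrier

  num : ℕ → Carrier
  num = ιℕ commutativeRing

  sumUpTo : (ℕ → Carrier) → ℕ → Carrier
  sumUpTo f zero = f zero
  sumUpTo f (suc n) = sumUpTo f n + f (suc n)

  _⊛_ : Series → Series → Series
  (f ⊛ g) n = sumUpTo (λ k → f k * g (n ∸ k)) n

  _·ₛ_ : Carrier → Series → Series
  (λ' ·ₛ f) n = λ' * f n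

  -- polynomial given by its list of coefficients in ascending degree
  poly : List Carrier → Series
  poly [] n = 0#
  poly (a ∷ as) zero = a
  poly (a ∷ as) (suc n) = poly as n

  -- f is the power-series expansion of the rational function P/Q,
  -- i.e. Q · f = P as formal power series.
  IsExpansion : Series → Series → Series → Set ℓ
  IsExpansion P Q f = ∀ n → (Q ⊛ f) n ≈ P n

  -- normalized multiplicative:
  -- f = 1/(2 a₀) + Σ_{n≥1} aₙ qⁿ, a₀ ≠ 0, a₁ = 1, a_{mn} = a_m a_n for coprime m,n ≥ 1
  NormalizedMultiplicative : Series → Set (c ⊔ ℓ)
  NormalizedMultiplicative f =
    Σ Carrier (λ a₀ → ¬ (a₀ ≈ 0#) × f 0 * (a₀ + a₀) ≈ 1#)
    × f 1 ≈ 1#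
    × (∀ m n → m ≥ 1 → n ≥ 1 → Coprime m n → f (m ℕ.* n) ≈ f m * f n)

  Multiplicative : Series → Set (c ⊔ ℓ)
  Multiplicative f = Σ Carrier (λ λ' → NormalizedMultiplicative (λ' ·ₛ f))

  InX : Series → Set (c ⊔ ℓ)
  InX f = NormalizedMultiplicative f × Multiplicative (f ⊛ f)

{-# OPTIONS --safe #-}
-- Each series f in question is the expansion of P/Q with Q(0) invertible, so it is determined by
-- the recurrence Q·f = P, and f² by the recurrence Q·f² = P·f.  It therefore suffices to write
-- down closed forms for the coefficients of f and f² satisfying these recurrences; they are built
-- from n, n³, the character χ₃ modulo 3 and functions of n depending only on whether a prime
-- divides n, which makes their multiplicativity visible.  The primed cases reduce to the unprimed
-- ones: f(q) ↦ -f(-q) turns P/Q into -P(-q)/Q(-q) and preserves 𝒳, since it multiplies the n-th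
-- coefficient of f by the multiplicative function -(-1)ⁿ and that of f² by (-1)ⁿ.
module Submission where

open import Algebra.Bundles using (CommutativeRing)
import Algebra.Solver.Ring.AlmostCommutativeRing as ACR
open import Data.Empty using (⊥-elim)
open import Data.Integer as ℤ using (ℤ; +_; -[1+_])
import Data.Integer.Properties as ℤ
open import Data.List using ([]; _∷_)
open import Data.List.Relation.Binary.Pointwise using (Pointwise; []; _∷_)
open import Data.Maybe using (Maybe; just; nothing)
open import Data.Nat as ℕ using (ℕ; zero; suc; _<_; _≤_; _≥_; z≤n; s≤s; _∸_; NonZero)
import Data.Nat.Properties as ℕ
open import Data.Nat.Coprimality using (Coprime)
open import Data.Nat.Divisibility
  using (_∣?_; ∣-refl; ∣m+n∣m⇒∣n; ∣m∣n⇒∣m+n; ∣m⇒∣m*n; ∣n⇒∣m*n)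
open import Data.Nat.DivMod using (_%_; [m+n]%n≡m%n; %-distribˡ-*; m%n<n)
open import Data.Nat.Induction using (<-rec)
open import Data.Nat.Primality using (Prime; euclidsLemma; prime⇒nonTrivial; prime[2]; prime?)
open import Data.Product using (_×_; _,_; proj₁; proj₂)
open import Data.Sum using ([_,_])
import Relation.Binary.PropositionalEquality as ≡
open import Relation.Nullary using (¬_; yes; no)
open import Relation.Nullary.Decidable using (from-yes)
open import Defs

module IntegerCoefficients {c ℓ} (R : CommutativeRing c ℓ) where
  open CommutativeRing R
  open import Algebra.Properties.Ring ring using (-‿distribˡ-*; -‿distribʳ-*)
  open import Algebra.Properties.AbelianGroup +-abelianGroup using (⁻¹-∙-comm)
  open import Algebra.Properties.Group +-group using (⁻¹-involutive; ε⁻¹≈ε)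
  open import Algebra.Properties.CommutativeSemigroup +-commutativeSemigroup using (interchange)
  open import Relation.Binary.Reasoning.Setoid setoid

  ι : ℕ → Carrier
  ι = ιℕ R

  ι-+ : ∀ m n → ι (m ℕ.+ n) ≈ ι m + ι n
  ι-+ zero    n = sym (+-identityˡ _)
  ι-+ (suc m) n = trans (+-congˡ (ι-+ m n)) (sym (+-assoc _ _ _))

  ι-* : ∀ m n → ι (m ℕ.* n) ≈ ι m * ι n
  ι-* zero    n = sym (zeroˡ _)
  ι-* (suc m) n = begin
    ι (n ℕ.+ m ℕ.* n)     ≈⟨ ι-+ n (m ℕ.* n) ⟩
    ι n + ι (m ℕ.* n)     ≈⟨ +-cong (sym (*-identityˡ _)) (ι-* m n) ⟩
    1# * ι n + ι m * ι n  ≈⟨ distribʳ _ _ _ ⟨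
    (1# + ι m) * ι n      ∎

  ιℤ : ℤ → Carrier
  ιℤ (+ n)      = ι n
  ιℤ -[1+ n ]   = - ι (suc n)

  ιℤ-neg : ∀ i → ιℤ (ℤ.- i) ≈ - ιℤ i
  ιℤ-neg -[1+ n ]    = sym (⁻¹-involutive _)
  ιℤ-neg (+ zero)    = sym ε⁻¹≈ε
  ιℤ-neg (+ (suc n)) = refl

  ιℤ-⊖ : ∀ m n → ιℤ (m ℤ.⊖ n) ≈ ι m - ι n
  ιℤ-⊖ m       zero    = sym (trans (+-congˡ ε⁻¹≈ε) (+-identityʳ _))
  ιℤ-⊖ zero    (suc n) = sym (+-identityˡ _)
  ιℤ-⊖ (suc m) (suc n) = begin
    ιℤ (suc m ℤ.⊖ suc n)             ≡⟨ ≡.cong ιℤ (ℤ.[1+m]⊖[1+n]≡m⊖n m n) ⟩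
    ιℤ (m ℤ.⊖ n)                     ≈⟨ ιℤ-⊖ m n ⟩
    ι m - ι n                        ≈⟨ +-identityˡ _ ⟨
    0# + (ι m - ι n)                 ≈⟨ +-congʳ (-‿inverseʳ 1#) ⟨
    (1# - 1#) + (ι m - ι n)          ≈⟨ interchange _ _ _ _ ⟨
    (1# + ι m) + (- 1# - ι n)        ≈⟨ +-congˡ (⁻¹-∙-comm 1# (ι n)) ⟩
    (1# + ι m) - (1# + ι n)          ∎

  ιℤ-+ : ∀ i j → ιℤ (i ℤ.+ j) ≈ ιℤ i + ιℤ j
  ιℤ-+ (+ m)      (+ n)      = ι-+ m n
  ιℤ-+ (+ m)      -[1+ n ]   = ιℤ-⊖ m (suc n)
  ιℤ-+ -[1+ m ]   (+ n)      = trans (ιℤ-⊖ n (suc m)) (+-comm _ _)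
  ιℤ-+ -[1+ m ]   -[1+ n ]   = begin
    - ι (suc (suc (m ℕ.+ n)))        ≡⟨ ≡.cong (λ k → - ι (suc k)) (ℕ.+-suc m n) ⟨
    - ι (suc m ℕ.+ suc n)            ≈⟨ -‿cong (ι-+ (suc m) (suc n)) ⟩
    - (ι (suc m) + ι (suc n))        ≈⟨ ⁻¹-∙-comm _ _ ⟨
    - ι (suc m) - ι (suc n)          ∎

  ιℤ-* : ∀ i j → ιℤ (i ℤ.* j) ≈ ιℤ i * ιℤ j
  ιℤ-* (+ m) (+ n) rewrite ℤ.+◃n≡+n (m ℕ.* n) = ι-* m n
  ιℤ-* (+ m) -[1+ n ] rewrite ℤ.-◃n≡-n (m ℕ.* suc n) =
    trans (ιℤ-neg (+ (m ℕ.* suc n))) (trans (-‿cong (ι-* m (suc n))) (-‿distribʳ-* _ _))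
  ιℤ-* -[1+ m ] (+ n) rewrite ℤ.-◃n≡-n (suc m ℕ.* n) =
    trans (ιℤ-neg (+ (suc m ℕ.* n))) (trans (-‿cong (ι-* (suc m) n)) (-‿distribˡ-* _ _))
  ιℤ-* -[1+ m ] -[1+ n ] = begin
    ι (suc m ℕ.* suc n)              ≈⟨ ι-* (suc m) (suc n) ⟩
    ι (suc m) * ι (suc n)            ≈⟨ ⁻¹-involutive _ ⟨
    - - (ι (suc m) * ι (suc n))      ≈⟨ -‿cong (-‿distribˡ-* _ _) ⟩
    - (- ι (suc m) * ι (suc n))      ≈⟨ -‿distribʳ-* _ _ ⟩
    - ι (suc m) * - ι (suc n)        ∎

  -- ι with 1 sent to 1# itself, so that the solver's constants are
  -- definitionally the 0#, 1# and numerals that occur in goals.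
  ιᶜ : ℕ → Carrier
  ιᶜ zero            = 0#
  ιᶜ (suc zero)      = 1#
  ιᶜ n@(suc (suc _)) = ι n

  ⟦_⟧ : ℤ → Carrier
  ⟦ + n ⟧      = ιᶜ n
  ⟦ -[1+ n ] ⟧ = - ιᶜ (suc n)

  ⟦⟧≈ιℤ : ∀ i → ⟦ i ⟧ ≈ ιℤ i
  ⟦⟧≈ιℤ (+ zero)          = refl
  ⟦⟧≈ιℤ (+ suc zero)      = sym (+-identityʳ 1#)
  ⟦⟧≈ιℤ (+ suc (suc n))   = refl
  ⟦⟧≈ιℤ -[1+ zero ]       = -‿cong (sym (+-identityʳ 1#))
  ⟦⟧≈ιℤ -[1+ suc n ]      = refl

  ACRing : ACR.AlmostCommutativeRing c ℓ
  ACRing = ACR.fromCommutativeRing R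

  ⟦⟧-morphism : ℤ.+-*-rawRing ACR.-Raw-AlmostCommutative⟶ ACRing
  ⟦⟧-morphism = record
    { ⟦_⟧    = ⟦_⟧
    ; +-homo = λ i j → transport (ℤ._+_ i j) (ιℤ-+ i j) (+-cong (⟦⟧≈ιℤ i) (⟦⟧≈ιℤ j))
    ; *-homo = λ i j → transport (ℤ._*_ i j) (ιℤ-* i j) (*-cong (⟦⟧≈ιℤ i) (⟦⟧≈ιℤ j))
    ; -‿homo = λ i → transport (ℤ.- i) (ιℤ-neg i) (-‿cong (⟦⟧≈ιℤ i))
    ; 0-homo = refl
    ; 1-homo = refl
    }
    where
    transport : ∀ k {x y} → ιℤ k ≈ x → y ≈ x → ⟦ k ⟧ ≈ y
    transport k e e′ = trans (⟦⟧≈ιℤ k) (trans e (sym e′))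

  _≟⟦⟧_ : ∀ i j → Maybe (⟦ i ⟧ ≈ ⟦ j ⟧)
  i ≟⟦⟧ j with i ℤ.≟ j
  ... | yes ≡.refl = just refl
  ... | no _       = nothing

  open import Algebra.Solver.Ring ℤ.+-*-rawRing ACRing ⟦⟧-morphism _≟⟦⟧_ public
    using (Polynomial; solve; _:=_; _:+_; _:*_; :-_; _:-_) renaming (con to conℤ)

  con : ∀ {n} → ℕ → Polynomial n
  con k = conℤ (+ k)

  :suc : ∀ {n} → Polynomial n → Polynomial n
  :suc p = con 1 :+ p

module Expansions {c ℓ} (K : CharZeroField c ℓ) where
  open CharZeroField K using (commutativeRing; inverse; charZero)
  open CommutativeRing commutativeRing
  open PowerSeries K
  open IntegerCoefficients commutativeRing using (ι-*; solve; _:=_; _:+_; _:*_; :-_; _:-_; con; :suc)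
  open import Algebra.Properties.Ring ring using (-‿distribˡ-*)
  open import Algebra.Properties.Group +-group using (⁻¹-involutive; ∙-cancelʳ)
  open import Algebra.Properties.CommutativeSemigroup +-commutativeSemigroup using (interchange)
  open import Relation.Binary.Reasoning.Setoid setoid

  1#≉0# : ¬ 1# ≈ 0#
  1#≉0# 1≈0 = charZero 0 (trans (+-identityʳ 1#) 1≈0)

  *-cancelˡ-unit : ∀ {a y x x′} → a * y ≈ 1# → a * x ≈ a * x′ → x ≈ x′
  *-cancelˡ-unit {a} {y} {x} {x′} ay≈1 ax≈ax′ = begin
    x             ≈⟨ unit-cancel x ⟨
    y * (a * x)   ≈⟨ *-congˡ ax≈ax′ ⟩
    y * (a * x′)  ≈⟨ unit-cancel x′ ⟩
    x′            ∎
    where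
    unit-cancel : ∀ z → y * (a * z) ≈ z
    unit-cancel z = begin
      y * (a * z)  ≈⟨ solve 3 (λ a y z → y :* (a :* z) := (a :* y) :* z) refl a y z ⟩
      (a * y) * z  ≈⟨ *-congʳ ay≈1 ⟩
      1# * z       ≈⟨ *-identityˡ z ⟩
      z            ∎

  -- Identities involving a chosen inverse y of q are ring identities modulo
  -- q * y - 1: it suffices to exhibit the cofactor A.
  ≈-modulo : ∀ {u L R} A → u ≈ 1# → L ≈ R + (u - 1#) * A → L ≈ R
  ≈-modulo {u} {L} {R} A u≈1 L≈R+[u-1]A = begin
    L                   ≈⟨ L≈R+[u-1]A ⟩
    R + (u - 1#) * A    ≈⟨ +-congˡ (*-congʳ (+-congʳ u≈1)) ⟩
    R + (1# - 1#) * A   ≈⟨ +-congˡ (*-congʳ (-‿inverseʳ 1#)) ⟩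
    R + 0# * A          ≈⟨ +-congˡ (zeroˡ A) ⟩
    R + 0#              ≈⟨ +-identityʳ R ⟩
    R                   ∎

  infix 4 _≗_
  _≗_ : Series → Series → Set ℓ
  A ≗ B = ∀ n → A n ≈ B n

  ≗-refl : ∀ {A} → A ≗ A
  ≗-refl _ = refl

  infixl 6 _⊕_
  _⊕_ : Series → Series → Series
  (A ⊕ B) n = A n + B n

  shift : Series → Series
  shift A zero    = 0#
  shift A (suc n) = A n

  sumUpTo-cong : ∀ {f g} n → (∀ k → k ≤ n → f k ≈ g k) → sumUpTo f n ≈ sumUpTo g n
  sumUpTo-cong zero    f≈g = f≈g 0 z≤n
  sumUpTo-cong (suc n) f≈g =
    +-cong (sumUpTo-cong n (λ k k≤n → f≈g k (ℕ.m≤n⇒m≤1+n k≤n))) (f≈g (suc n) ℕ.≤-refl)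

  sumUpTo-suc : ∀ f n → sumUpTo f (suc n) ≈ f 0 + sumUpTo (λ k → f (suc k)) n
  sumUpTo-suc f zero    = refl
  sumUpTo-suc f (suc n) = trans (+-congʳ (sumUpTo-suc f n)) (+-assoc _ _ _)

  sumUpTo-+ : ∀ f g n → sumUpTo (λ k → f k + g k) n ≈ sumUpTo f n + sumUpTo g n
  sumUpTo-+ f g zero    = refl
  sumUpTo-+ f g (suc n) = trans (+-congʳ (sumUpTo-+ f g n)) (interchange _ _ _ _)

  sumUpTo-*ˡ : ∀ a f n → sumUpTo (λ k → a * f k) n ≈ a * sumUpTo f n
  sumUpTo-*ˡ a f zero    = refl
  sumUpTo-*ˡ a f (suc n) = trans (+-congʳ (sumUpTo-*ˡ a f n)) (sym (distribˡ _ _ _))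

  sumUpTo-zero : ∀ {f} n → (∀ k → f k ≈ 0#) → sumUpTo f n ≈ 0#
  sumUpTo-zero zero    f≈0 = f≈0 0
  sumUpTo-zero (suc n) f≈0 = trans (+-cong (sumUpTo-zero n f≈0) (f≈0 (suc n))) (+-identityʳ 0#)

  ⊛-cong : ∀ {A A′ B B′} → A ≗ A′ → B ≗ B′ → A ⊛ B ≗ A′ ⊛ B′
  ⊛-cong A≗A′ B≗B′ n = sumUpTo-cong n (λ k _ → *-cong (A≗A′ k) (B≗B′ (n ∸ k)))

  ⊛-distribˡ-⊕ : ∀ A B C → A ⊛ (B ⊕ C) ≗ A ⊛ B ⊕ A ⊛ C
  ⊛-distribˡ-⊕ A B C n = trans (sumUpTo-cong n (λ k _ → distribˡ _ _ _)) (sumUpTo-+ _ _ n)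

  ⊛-distribʳ-⊕ : ∀ A B C → (A ⊕ B) ⊛ C ≗ A ⊛ C ⊕ B ⊛ C
  ⊛-distribʳ-⊕ A B C n = trans (sumUpTo-cong n (λ k _ → distribʳ _ _ _)) (sumUpTo-+ _ _ n)

  ·ₛ-⊛ : ∀ a A B → (a ·ₛ A) ⊛ B ≗ a ·ₛ (A ⊛ B)
  ·ₛ-⊛ a A B n = trans (sumUpTo-cong n (λ k _ → *-assoc _ _ _)) (sumUpTo-*ˡ a _ n)

  ⊛-·ₛ : ∀ a A B → A ⊛ (a ·ₛ B) ≗ a ·ₛ (A ⊛ B)
  ⊛-·ₛ a A B n = trans (sumUpTo-cong n (λ k _ → x*[a*y]≈a*[x*y] _ _ _)) (sumUpTo-*ˡ a _ n)
    where
    x*[a*y]≈a*[x*y] : ∀ x a y → x * (a * y) ≈ a * (x * y)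
    x*[a*y]≈a*[x*y] = solve 3 (λ x a y → x :* (a :* y) := a :* (x :* y)) refl

  ⊛-zeroˡ : ∀ {A} B → (∀ n → A n ≈ 0#) → ∀ n → (A ⊛ B) n ≈ 0#
  ⊛-zeroˡ B A≈0 n = sumUpTo-zero n (λ k → trans (*-congʳ (A≈0 k)) (zeroˡ _))

  shift-⊛ : ∀ A B → shift A ⊛ B ≗ shift (A ⊛ B)
  shift-⊛ A B zero    = zeroˡ _
  shift-⊛ A B (suc n) = trans (sumUpTo-suc _ n) (trans (+-congʳ (zeroˡ _)) (+-identityˡ _))

  poly-∷-⊛ : ∀ a as B → poly (a ∷ as) ⊛ B ≗ a ·ₛ B ⊕ shift (poly as ⊛ B)
  poly-∷-⊛ a as B zero    = sym (+-identityʳ _)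
  poly-∷-⊛ a as B (suc n) = sumUpTo-suc _ n

  poly-⊛-assoc : ∀ as B C → poly as ⊛ (B ⊛ C) ≗ (poly as ⊛ B) ⊛ C
  poly-⊛-assoc []       B C n =
    trans (⊛-zeroˡ (B ⊛ C) (λ _ → refl) n) (sym (⊛-zeroˡ C (⊛-zeroˡ B (λ _ → refl)) n))
  poly-⊛-assoc (a ∷ as) B C n = begin
    (poly (a ∷ as) ⊛ (B ⊛ C)) n
      ≈⟨ poly-∷-⊛ a as (B ⊛ C) n ⟩
    (a ·ₛ (B ⊛ C) ⊕ shift (poly as ⊛ (B ⊛ C))) n
      ≈⟨ +-cong (·ₛ-⊛ a B C n) (shift-cong (λ k → sym (poly-⊛-assoc as B C k)) n) ⟨
    ((a ·ₛ B) ⊛ C ⊕ shift ((poly as ⊛ B) ⊛ C)) n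
      ≈⟨ +-congˡ (shift-⊛ (poly as ⊛ B) C n) ⟨
    ((a ·ₛ B) ⊛ C ⊕ shift (poly as ⊛ B) ⊛ C) n
      ≈⟨ ⊛-distribʳ-⊕ _ _ C n ⟨
    ((a ·ₛ B ⊕ shift (poly as ⊛ B)) ⊛ C) n
      ≈⟨ ⊛-cong {B = C} (poly-∷-⊛ a as B) ≗-refl n ⟨
    ((poly (a ∷ as) ⊛ B) ⊛ C) n
      ∎
    where
    shift-cong : ∀ {A A′} → A ≗ A′ → shift A ≗ shift A′
    shift-cong A≗A′ zero    = refl
    shift-cong A≗A′ (suc n) = A≗A′ n

  poly-cong : ∀ {as bs} → Pointwise _≈_ as bs → poly as ≗ poly bs
  poly-cong []          n       = refl
  poly-cong (a≈b ∷ _)   zero    = a≈b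
  poly-cong (_ ∷ as≈bs) (suc n) = poly-cong as≈bs n

  conv₂ : Carrier → Carrier → Carrier → Series → Series
  conv₂ a b c X zero          = a * X 0
  conv₂ a b c X (suc zero)    = a * X 1 + b * X 0
  conv₂ a b c X (suc (suc n)) = a * X (suc (suc n)) + b * X (suc n) + c * X n

  poly₂-⊛ : ∀ a b c X → poly (a ∷ b ∷ c ∷ []) ⊛ X ≗ conv₂ a b c X
  poly₂-⊛ a b c X zero          = refl
  poly₂-⊛ a b c X (suc zero)    = refl
  poly₂-⊛ a b c X (suc (suc n)) = begin
    (poly (a ∷ b ∷ c ∷ []) ⊛ X) (suc (suc n))       ≈⟨ poly-∷-⊛ a _ X (suc (suc n)) ⟩
    a * X (suc (suc n)) + (poly (b ∷ c ∷ []) ⊛ X) (suc n)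
      ≈⟨ +-congˡ (poly-∷-⊛ b _ X (suc n)) ⟩
    a * X (suc (suc n)) + (b * X (suc n) + (poly (c ∷ []) ⊛ X) n)
      ≈⟨ +-congˡ (+-congˡ (trans (poly-∷-⊛ c [] X n) (+-congˡ (shift-zero n)))) ⟩
    a * X (suc (suc n)) + (b * X (suc n) + (c * X n + 0#))
      ≈⟨ +-congˡ (+-congˡ (+-identityʳ _)) ⟩
    a * X (suc (suc n)) + (b * X (suc n) + c * X n)   ≈⟨ +-assoc _ _ _ ⟨
    conv₂ a b c X (suc (suc n))                       ∎
    where
    shift-zero : ∀ n → shift (poly [] ⊛ X) n ≈ 0#
    shift-zero zero    = refl
    shift-zero (suc n) = ⊛-zeroˡ X (λ _ → refl) n

  scaled-square : ∀ a u v → a ·ₛ (poly (u ∷ v ∷ []) ⊛ poly (u ∷ v ∷ [])) ≗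
                  poly (a * (u * u) ∷ a * (u * v + v * u) ∷ a * (v * v) ∷ [])
  scaled-square a u v n = trans (*-congˡ (trans (⊛-cong {B = L} linear-as-quadratic ≗-refl n)
                                                (poly₂-⊛ u v 0# L n)))
                                (coefficients n)
    where
    L : Series
    L = poly (u ∷ v ∷ [])
    linear-as-quadratic : L ≗ poly (u ∷ v ∷ 0# ∷ [])
    linear-as-quadratic 0                   = refl
    linear-as-quadratic 1                   = refl
    linear-as-quadratic 2                   = refl
    linear-as-quadratic (suc (suc (suc _))) = refl
    coefficients : ∀ n →
      a * conv₂ u v 0# L n ≈ poly (a * (u * u) ∷ a * (u * v + v * u) ∷ a * (v * v) ∷ []) n
    coefficients 0 = refl
    coefficients 1 = refl
    coefficients 2 =
      solve 3 (λ a u v → a :* (u :* con 0 :+ v :* v :+ con 0 :* u) := a :* (v :* v)) refl a u v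
    coefficients (suc (suc (suc n))) =
      solve 4 (λ a u v x → a :* (u :* con 0 :+ v :* con 0 :+ con 0 :* x) := con 0) refl a u v (L (suc n))

  ⊛-cancelˡ : ∀ {Q X Y y} → Q 0 * y ≈ 1# → Q ⊛ X ≗ Q ⊛ Y → X ≗ Y
  ⊛-cancelˡ {Q} {X} {Y} Q₀y≈1 QX≗QY = <-rec (λ n → X n ≈ Y n) step
    where
    step : ∀ n → (∀ {m} → m < n → X m ≈ Y m) → X n ≈ Y n
    step zero    _   = *-cancelˡ-unit Q₀y≈1 (QX≗QY 0)
    step (suc n) rec = *-cancelˡ-unit Q₀y≈1 (∙-cancelʳ _ _ _ (begin
      Q 0 * X (suc n) + tail X   ≈⟨ sumUpTo-suc _ n ⟨
      (Q ⊛ X) (suc n)            ≈⟨ QX≗QY (suc n) ⟩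
      (Q ⊛ Y) (suc n)            ≈⟨ sumUpTo-suc _ n ⟩
      Q 0 * Y (suc n) + tail Y   ≈⟨ +-congˡ tails-agree ⟨
      Q 0 * Y (suc n) + tail X   ∎))
      where
      tail : Series → Carrier
      tail Z = sumUpTo (λ k → Q (suc k) * Z (n ∸ k)) n
      tails-agree : tail X ≈ tail Y
      tails-agree = sumUpTo-cong n (λ k _ → *-congˡ (rec (s≤s (ℕ.m∸n≤m n k))))

  IsExpansion-cong : ∀ {P P′ Q Q′} f → P ≗ P′ → Q ≗ Q′ →
                     IsExpansion P Q f → IsExpansion P′ Q′ f
  IsExpansion-cong f P≗P′ Q≗Q′ Qf≗P n =
    trans (⊛-cong {B = f} (λ k → sym (Q≗Q′ k)) ≗-refl n) (trans (Qf≗P n) (P≗P′ n))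

  IsExpansion-unique : ∀ {P Q y} f g → Q 0 * y ≈ 1# →
                       IsExpansion P Q f → IsExpansion P Q g → f ≗ g
  IsExpansion-unique f g Q₀y≈1 Qf≗P Qg≗P =
    ⊛-cancelˡ Q₀y≈1 (λ n → trans (Qf≗P n) (sym (Qg≗P n)))

  IsExpansion-⊛ : ∀ {P qs f} g → IsExpansion P (poly qs) f → IsExpansion (P ⊛ g) (poly qs) (f ⊛ g)
  IsExpansion-⊛ {qs = qs} {f} g Qf≗P n =
    trans (poly-⊛-assoc qs f g n) (⊛-cong {B = g} Qf≗P ≗-refl n)

  IsExpansion-⊕ : ∀ {P P′ Q} a f f′ → IsExpansion P Q f → IsExpansion P′ Q f′ →
                  IsExpansion (a ·ₛ P ⊕ P′) Q (a ·ₛ f ⊕ f′)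
  IsExpansion-⊕ {P} {P′} {Q} a f f′ Qf≗P Qf′≗P′ n = begin
    (Q ⊛ (a ·ₛ f ⊕ f′)) n          ≈⟨ ⊛-distribˡ-⊕ Q (a ·ₛ f) f′ n ⟩
    (Q ⊛ (a ·ₛ f)) n + (Q ⊛ f′) n  ≈⟨ +-cong (⊛-·ₛ a Q f n) (Qf′≗P′ n) ⟩
    a * (Q ⊛ f) n + P′ n           ≈⟨ +-congʳ (*-congˡ (Qf≗P n)) ⟩
    a * P n + P′ n                 ∎

  CoprimeMultiplicative : (ℕ → Carrier) → Set ℓ
  CoprimeMultiplicative φ =
    ∀ m n → m ≥ 1 → n ≥ 1 → Coprime m n → φ (m ℕ.* n) ≈ φ m * φ n

  coprimeMultiplicative-cong : ∀ {φ ψ} → (∀ n → φ (suc n) ≈ ψ (suc n)) →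
                               CoprimeMultiplicative φ → CoprimeMultiplicative ψ
  coprimeMultiplicative-cong φ≈ψ φ-mult (suc m) (suc n) m≥1 n≥1 coprime =
    trans (sym (φ≈ψ (n ℕ.+ m ℕ.* suc n)))
      (trans (φ-mult (suc m) (suc n) m≥1 n≥1 coprime) (*-cong (φ≈ψ m) (φ≈ψ n)))

  coprimeMultiplicative-* : ∀ {φ ψ} → CoprimeMultiplicative φ → CoprimeMultiplicative ψ →
                            CoprimeMultiplicative (λ n → φ n * ψ n)
  coprimeMultiplicative-* φ-mult ψ-mult m n m≥1 n≥1 coprime =
    trans (*-cong (φ-mult m n m≥1 n≥1 coprime) (ψ-mult m n m≥1 n≥1 coprime))
      (solve 4 (λ a b c d → (a :* b) :* (c :* d) := (a :* c) :* (b :* d)) refl _ _ _ _)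

  num-coprimeMultiplicative : CoprimeMultiplicative num
  num-coprimeMultiplicative m n _ _ _ = ι-* m n

  whenDivides : ℕ → Carrier → ℕ → Carrier
  whenDivides p κ n with p ∣? n
  ... | yes _ = κ
  ... | no  _ = 1#

  whenDivides-periodic : ∀ p κ n → whenDivides p κ (p ℕ.+ n) ≈ whenDivides p κ n
  whenDivides-periodic p κ n with p ∣? (p ℕ.+ n) | p ∣? n
  ... | yes _     | yes _    = refl
  ... | no  _     | no  _    = refl
  ... | yes p∣p+n | no  p∤n  = ⊥-elim (p∤n (∣m+n∣m⇒∣n p∣p+n ∣-refl))
  ... | no  p∤p+n | yes p∣n  = ⊥-elim (p∤p+n (∣m∣n⇒∣m+n ∣-refl p∣n))

  whenDivides-coprimeMultiplicative : ∀ {p} → Prime p → ∀ κ →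
                                      CoprimeMultiplicative (whenDivides p κ)
  whenDivides-coprimeMultiplicative {p} p-prime κ m n _ _ coprime
    with p ∣? (m ℕ.* n) | p ∣? m | p ∣? n
  ... | _         | yes p∣m | yes p∣n = ⊥-elim (p≢1 (coprime (p∣m , p∣n)))
    where
    p≢1 : ¬ p ≡.≡ 1
    p≢1 = ℕ.nonTrivial⇒≢1 {{prime⇒nonTrivial p-prime}}
  ... | yes _     | yes _   | no _    = sym (*-identityʳ κ)
  ... | yes _     | no _    | yes _   = sym (*-identityˡ κ)
  ... | yes p∣mn  | no p∤m  | no p∤n  = ⊥-elim ([ p∤m , p∤n ] (euclidsLemma m n p-prime p∣mn))
  ... | no p∤mn   | yes p∣m | _       = ⊥-elim (p∤mn (∣m⇒∣m*n n p∣m))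
  ... | no p∤mn   | no _    | yes p∣n = ⊥-elim (p∤mn (∣n⇒∣m*n m p∣n))
  ... | no _      | no _    | no _    = sym (*-identityˡ 1#)

  periodic-≈ : ∀ p .{{_ : NonZero p}} {φ ψ : ℕ → Carrier} →
               (∀ n → φ (p ℕ.+ n) ≈ φ n) → (∀ n → ψ (p ℕ.+ n) ≈ ψ n) →
               (∀ k → k < p → φ k ≈ ψ k) → ∀ n → φ n ≈ ψ n
  periodic-≈ p {φ} {ψ} φ-periodic ψ-periodic agree = <-rec (λ n → φ n ≈ ψ n) step
    where
    step : ∀ n → (∀ {m} → m < n → φ m ≈ ψ m) → φ n ≈ ψ n
    step n rec with n ℕ.<? p
    ... | yes n<p = agree n n<p
    ... | no  n≮p = begin
      φ n              ≡⟨ ≡.cong φ n≡p+r ⟩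
      φ (p ℕ.+ r)      ≈⟨ φ-periodic r ⟩
      φ r              ≈⟨ rec (ℕ.∸-monoʳ-< (ℕ.>-nonZero⁻¹ p) p≤n) ⟩
      ψ r              ≈⟨ ψ-periodic r ⟨
      ψ (p ℕ.+ r)      ≡⟨ ≡.cong ψ n≡p+r ⟨
      ψ n              ∎
      where
      r : ℕ
      r = n ∸ p
      p≤n : p ≤ n
      p≤n = ℕ.≮⇒≥ n≮p
      n≡p+r : n ≡.≡ p ℕ.+ r
      n≡p+r = ≡.sym (ℕ.m+[n∸m]≡n p≤n)

  normalizedMultiplicative : ∀ {f} a₀ → f 0 * (a₀ + a₀) ≈ 1# → f 1 ≈ 1# →
                             CoprimeMultiplicative f → NormalizedMultiplicative f
  normalizedMultiplicative {f} a₀ f₀[2a₀]≈1 f₁≈1 f-mult =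
    (a₀ , a₀≉0 , f₀[2a₀]≈1) , f₁≈1 , f-mult
    where
    a₀≉0 : ¬ a₀ ≈ 0#
    a₀≉0 a₀≈0 = 1#≉0# (begin
      1#                ≈⟨ f₀[2a₀]≈1 ⟨
      f 0 * (a₀ + a₀)   ≈⟨ *-congˡ (trans (+-cong a₀≈0 a₀≈0) (+-identityʳ 0#)) ⟩
      f 0 * 0#          ≈⟨ zeroʳ _ ⟩
      0#                ∎)

  normalizedMultiplicative-cong : ∀ {A B} → A ≗ B →
                                  NormalizedMultiplicative A → NormalizedMultiplicative B
  normalizedMultiplicative-cong A≗B ((a₀ , a₀≉0 , A₀[2a₀]≈1) , A₁≈1 , A-mult) =
    (a₀ , a₀≉0 , trans (*-congʳ (sym (A≗B 0))) A₀[2a₀]≈1) ,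
    trans (sym (A≗B 1)) A₁≈1 ,
    λ m n m≥1 n≥1 coprime →
      trans (sym (A≗B (m ℕ.* n))) (trans (A-mult m n m≥1 n≥1 coprime) (*-cong (A≗B m) (A≗B n)))

  multiplicative-cong : ∀ {A B} → A ≗ B → Multiplicative A → Multiplicative B
  multiplicative-cong A≗B (λ′ , λ′A-nm) =
    λ′ , normalizedMultiplicative-cong (λ n → *-congˡ (A≗B n)) λ′A-nm

  InX-cong : ∀ {f g} → f ≗ g → InX f → InX g
  InX-cong f≗g (f-nm , ff-mult) =
    normalizedMultiplicative-cong f≗g f-nm , multiplicative-cong (⊛-cong f≗g f≗g) ff-mult

  InX-of-closedForms : ∀ qs {P F H y} → poly qs 0 * y ≈ 1# →
                       IsExpansion P (poly qs) F → IsExpansion (P ⊛ F) (poly qs) H →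
                       NormalizedMultiplicative F → Multiplicative H →
                       ∀ f → IsExpansion P (poly qs) f → InX f
  InX-of-closedForms qs {P} {F} {H} Q₀y≈1 F-exp H-exp F-nm H-mult f f-exp =
    normalizedMultiplicative-cong (λ n → sym (f≗F n)) F-nm ,
    multiplicative-cong (λ n → sym (ff≗H n)) H-mult
    where
    f≗F : f ≗ F
    f≗F = IsExpansion-unique f F Q₀y≈1 f-exp F-exp
    ff≗H : f ⊛ f ≗ H
    ff≗H = IsExpansion-unique (f ⊛ f) H Q₀y≈1
             (IsExpansion-cong (f ⊛ f) (⊛-cong {A = P} ≗-refl f≗F) ≗-refl
               (IsExpansion-⊛ {qs = qs} f f-exp))
             H-exp

  InX-of-recurrences : ∀ {q₀ q₁ q₂ p₀ p₁ p₂ F H y} → q₀ * y ≈ 1# →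
                       conv₂ q₀ q₁ q₂ F ≗ poly (p₀ ∷ p₁ ∷ p₂ ∷ []) →
                       conv₂ q₀ q₁ q₂ H ≗ conv₂ p₀ p₁ p₂ F →
                       NormalizedMultiplicative F → Multiplicative H →
                       ∀ f → IsExpansion (poly (p₀ ∷ p₁ ∷ p₂ ∷ [])) (poly (q₀ ∷ q₁ ∷ q₂ ∷ [])) f →
                       InX f
  InX-of-recurrences {q₀} {q₁} {q₂} {p₀} {p₁} {p₂} {F} {H} q₀y≈1 F-rec H-rec =
    InX-of-closedForms (q₀ ∷ q₁ ∷ q₂ ∷ []) q₀y≈1
      (λ n → trans (poly₂-⊛ q₀ q₁ q₂ F n) (F-rec n))
      (λ n → trans (poly₂-⊛ q₀ q₁ q₂ H n) (trans (H-rec n) (sym (poly₂-⊛ p₀ p₁ p₂ F n))))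

  sgn : ℕ → Carrier
  sgn zero    = 1#
  sgn (suc n) = - sgn n

  sgn-+ : ∀ m n → sgn (m ℕ.+ n) ≈ sgn m * sgn n
  sgn-+ zero    n = sym (*-identityˡ _)
  sgn-+ (suc m) n = trans (-‿cong (sgn-+ m n)) (-‿distribˡ-* _ _)

  sgn-square : ∀ n → sgn n * sgn n ≈ 1#
  sgn-square zero    = *-identityˡ 1#
  sgn-square (suc n) = trans (solve 1 (λ s → (:- s) :* (:- s) := s :* s) refl (sgn n)) (sgn-square n)

  alt : Series → Series
  alt A n = sgn n * A n

  alt-⊛ : ∀ A B → alt (A ⊛ B) ≗ alt A ⊛ alt B
  alt-⊛ A B n = trans (sym (sumUpTo-*ˡ (sgn n) _ n)) (sumUpTo-cong n λ k k≤n → begin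
    sgn n * (A k * B (n ∸ k))
      ≈⟨ *-congʳ (trans (reflexive (≡.cong sgn (≡.sym (ℕ.m+[n∸m]≡n k≤n)))) (sgn-+ k (n ∸ k))) ⟩
    (sgn k * sgn (n ∸ k)) * (A k * B (n ∸ k))
      ≈⟨ solve 4 (λ s t a b → (s :* t) :* (a :* b) := (s :* a) :* (t :* b)) refl _ _ _ _ ⟩
    (sgn k * A k) * (sgn (n ∸ k) * B (n ∸ k))
      ∎)

  twist : Series → Series
  twist A = (- 1#) ·ₛ alt A

  twist-involutive : ∀ A → twist (twist A) ≗ A
  twist-involutive A n = begin
    - 1# * (sgn n * (- 1# * (sgn n * A n)))
      ≈⟨ solve 2 (λ s a → :- con 1 :* (s :* (:- con 1 :* (s :* a))) := (s :* s) :* a)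
               refl (sgn n) (A n) ⟩
    (sgn n * sgn n) * A n   ≈⟨ *-congʳ (sgn-square n) ⟩
    1# * A n                ≈⟨ *-identityˡ (A n) ⟩
    A n                     ∎

  twist-⊛-twist : ∀ A B → twist A ⊛ twist B ≗ alt (A ⊛ B)
  twist-⊛-twist A B n = begin
    (twist A ⊛ twist B) n                  ≈⟨ ·ₛ-⊛ (- 1#) (alt A) (twist B) n ⟩
    - 1# * (alt A ⊛ twist B) n             ≈⟨ *-congˡ (⊛-·ₛ (- 1#) (alt A) (alt B) n) ⟩
    - 1# * (- 1# * (alt A ⊛ alt B) n)      ≈⟨ solve 1 (λ x → :- con 1 :* (:- con 1 :* x) := x) refl _ ⟩
    (alt A ⊛ alt B) n                      ≈⟨ alt-⊛ A B n ⟨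
    alt (A ⊛ B) n                          ∎

  IsExpansion-twist : ∀ {P Q} f → IsExpansion P Q f → IsExpansion (twist P) (alt Q) (twist f)
  IsExpansion-twist {P} {Q} f Qf≗P n = begin
    (alt Q ⊛ twist f) n              ≈⟨ ⊛-·ₛ (- 1#) (alt Q) (alt f) n ⟩
    - 1# * (alt Q ⊛ alt f) n         ≈⟨ *-congˡ (alt-⊛ Q f n) ⟨
    - 1# * (sgn n * (Q ⊛ f) n)       ≈⟨ *-congˡ (*-congˡ (Qf≗P n)) ⟩
    twist P n                        ∎

  -sgn≈whenDivides : ∀ n → - 1# * sgn (suc n) ≈ whenDivides 2 (- 1#) (suc n)
  -sgn≈whenDivides =
    periodic-≈ 2 (λ n → *-congˡ (⁻¹-involutive _)) (λ n → whenDivides-periodic 2 _ (suc n)) agree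
    where
    agree : ∀ k → k < 2 → - 1# * sgn (suc k) ≈ whenDivides 2 (- 1#) (suc k)
    agree 0 _ = solve 0 (:- con 1 :* (:- con 1) := con 1) refl
    agree 1 _ = solve 0 (:- con 1 :* (:- (:- con 1)) := :- con 1) refl
    agree (suc (suc _)) (s≤s (s≤s ()))

  normalizedMultiplicative-twist : ∀ {f} → NormalizedMultiplicative f →
                                   NormalizedMultiplicative (twist f)
  normalizedMultiplicative-twist {f} ((a₀ , _ , f₀[2a₀]≈1) , f₁≈1 , f-mult) =
    normalizedMultiplicative (- a₀)
      (trans (solve 2 (λ x a → (:- con 1 :* (con 1 :* x)) :* (:- a :+ :- a) := x :* (a :+ a))
                      refl (f 0) a₀)
             f₀[2a₀]≈1)
      (trans (solve 1 (λ x → :- con 1 :* (:- con 1 :* x) := x) refl (f 1)) f₁≈1)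
      (coprimeMultiplicative-cong (λ n → trans (*-congʳ (sym (-sgn≈whenDivides n))) (*-assoc _ _ _))
        (coprimeMultiplicative-* (whenDivides-coprimeMultiplicative prime[2] (- 1#)) f-mult))

  multiplicative-alt : ∀ {g} → Multiplicative g → Multiplicative (alt g)
  multiplicative-alt {g} (λ′ , λ′g-nm) =
    - λ′ , normalizedMultiplicative-cong
             (λ n → solve 3 (λ s l x → :- con 1 :* (s :* (l :* x)) := :- l :* (s :* x))
                            refl (sgn n) λ′ (g n))
             (normalizedMultiplicative-twist λ′g-nm)

  InX-twist : ∀ {f} → InX f → InX (twist f)
  InX-twist {f} (f-nm , ff-mult) =
    normalizedMultiplicative-twist f-nm ,
    multiplicative-cong (λ n → sym (twist-⊛-twist f f n)) (multiplicative-alt ff-mult)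

  InX-of-twisted : ∀ {P Q P′ Q′} → (∀ f → IsExpansion P Q f → InX f) →
                   twist P′ ≗ P → alt Q′ ≗ Q → ∀ f → IsExpansion P′ Q′ f → InX f
  InX-of-twisted InX-P/Q twistP′≗P altQ′≗Q f f-exp =
    InX-cong (twist-involutive f)
      (InX-twist (InX-P/Q (twist f)
        (IsExpansion-cong (twist f) twistP′≗P altQ′≗Q (IsExpansion-twist f f-exp))))

  alt-poly₂ : ∀ a b c → alt (poly (a ∷ b ∷ c ∷ [])) ≗ poly (a ∷ - b ∷ c ∷ [])
  alt-poly₂ a b c 0 = *-identityˡ a
  alt-poly₂ a b c 1 = solve 1 (λ b → :- con 1 :* b := :- b) refl b
  alt-poly₂ a b c 2 = solve 1 (λ c → :- (:- con 1) :* c := c) refl c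
  alt-poly₂ a b c (suc (suc (suc n))) = zeroʳ _

  twist-poly₂ : ∀ a b c → twist (poly (- a ∷ b ∷ - c ∷ [])) ≗ poly (a ∷ b ∷ c ∷ [])
  twist-poly₂ a b c n = trans (*-congˡ (alt-poly₂ (- a) b (- c) n)) (negate n)
    where
    negate : ∀ n → - 1# * poly (- a ∷ - b ∷ - c ∷ []) n ≈ poly (a ∷ b ∷ c ∷ []) n
    negate 0 = solve 1 (λ a → :- con 1 :* (:- a) := a) refl a
    negate 1 = solve 1 (λ b → :- con 1 :* (:- b) := b) refl b
    negate 2 = solve 1 (λ c → :- con 1 :* (:- c) := c) refl c
    negate (suc (suc (suc n))) = zeroʳ _

  period₂ : Carrier → Carrier → ℕ → Carrier
  period₂ a b zero          = a
  period₂ a b (suc zero)    = b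
  period₂ a b (suc (suc n)) = period₂ a b n

  period₃ : Carrier → Carrier → Carrier → ℕ → Carrier
  period₃ a b c zero                = a
  period₃ a b c (suc zero)          = b
  period₃ a b c (suc (suc zero))    = c
  period₃ a b c (suc (suc (suc n))) = period₃ a b c n

  χ₃ : ℕ → Carrier
  χ₃ = period₃ 0# 1# (- 1#)

  χ₃-mod : ∀ n → χ₃ n ≈ χ₃ (n % 3)
  χ₃-mod = periodic-≈ 3 (λ _ → refl) (λ n → reflexive (≡.cong χ₃ (3+n%3≡n%3 n))) agree
    where
    3+n%3≡n%3 : ∀ n → (3 ℕ.+ n) % 3 ≡.≡ n % 3
    3+n%3≡n%3 n = ≡.trans (≡.cong (_% 3) (ℕ.+-comm 3 n)) ([m+n]%n≡m%n n 3)
    agree : ∀ k → k < 3 → χ₃ k ≈ χ₃ (k % 3)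
    agree 0 _ = refl
    agree 1 _ = refl
    agree 2 _ = refl
    agree (suc (suc (suc _))) (s≤s (s≤s (s≤s ())))

  χ₃-* : ∀ m n → χ₃ (m ℕ.* n) ≈ χ₃ m * χ₃ n
  χ₃-* m n = begin
    χ₃ (m ℕ.* n)                         ≈⟨ χ₃-mod (m ℕ.* n) ⟩
    χ₃ ((m ℕ.* n) % 3)                   ≡⟨ ≡.cong χ₃ (%-distribˡ-* m n 3) ⟩
    χ₃ (((m % 3) ℕ.* (n % 3)) % 3)       ≈⟨ χ₃-mod ((m % 3) ℕ.* (n % 3)) ⟨
    χ₃ ((m % 3) ℕ.* (n % 3))             ≈⟨ on-residues (m % 3) (n % 3) (m%n<n m 3) (m%n<n n 3) ⟩
    χ₃ (m % 3) * χ₃ (n % 3)              ≈⟨ *-cong (χ₃-mod m) (χ₃-mod n) ⟨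
    χ₃ m * χ₃ n                          ∎
    where
    on-residues : ∀ a b → a < 3 → b < 3 → χ₃ (a ℕ.* b) ≈ χ₃ a * χ₃ b
    on-residues 0 b _ _ = sym (zeroˡ _)
    on-residues 1 0 _ _ = sym (zeroʳ _)
    on-residues 1 1 _ _ = sym (*-identityˡ _)
    on-residues 1 2 _ _ = sym (*-identityˡ _)
    on-residues 2 0 _ _ = sym (zeroʳ _)
    on-residues 2 1 _ _ = sym (*-identityʳ _)
    on-residues 2 2 _ _ = solve 0 (con 1 := :- con 1 :* :- con 1) refl
    on-residues (suc (suc (suc _))) _ (s≤s (s≤s (s≤s ()))) _
    on-residues (suc a) (suc (suc (suc _))) _ (s≤s (s≤s (s≤s ())))

  -- f = t + Σ aₙ qⁿ with aₙ = 1 for odd n and 2t for even n, and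
  -- f² = t² + Σ n bₙ qⁿ with bₙ = 2t for odd n and 2t² + 1/2 for even n.
  module Case-xii (t : Carrier) (t≉0 : ¬ t ≈ 0#) where
    ½ : Carrier
    ½ = proj₁ (inverse (num 2) (charZero 1))

    2½≈1 : num 2 * ½ ≈ 1#
    2½≈1 = proj₂ (inverse (num 2) (charZero 1))

    t+t≉0 : ¬ t + t ≈ 0#
    t+t≉0 t+t≈0 = t≉0 (begin
      t              ≈⟨ ≈-modulo (- t) 2½≈1 (solve 2 (λ t h →
                          t := h :* (t :+ t) :+ (con 2 :* h :- con 1) :* :- t) refl t ½) ⟩
      ½ * (t + t)    ≈⟨ *-congˡ t+t≈0 ⟩
      ½ * 0#         ≈⟨ zeroʳ ½ ⟩
      0#             ∎)

    j : Carrier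
    j = proj₁ (inverse (t + t) t+t≉0)

    [t+t]j≈1 : (t + t) * j ≈ 1#
    [t+t]j≈1 = proj₂ (inverse (t + t) t+t≉0)

    b-even : Carrier
    b-even = t * t + t * t + ½

    F : Series
    F zero    = t
    F (suc n) = period₂ 1# (t + t) n

    H : Series
    H zero    = t * t
    H (suc n) = num (suc n) * period₂ (t + t) b-even n

    F-recurrence : conv₂ 1# 0# (- 1#) F ≗ poly (t ∷ 1# ∷ t ∷ [])
    F-recurrence 0 = *-identityˡ t
    F-recurrence 1 = solve 1 (λ t → con 1 :* con 1 :+ con 0 :* t := con 1) refl t
    F-recurrence 2 = solve 1 (λ t → con 1 :* (t :+ t) :+ con 0 :* con 1 :+ :- con 1 :* t := t) refl t
    F-recurrence (suc (suc (suc m))) =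
      solve 2 (λ z w → con 1 :* z :+ con 0 :* w :+ :- con 1 :* z := con 0)
              refl (F (suc m)) (F (suc (suc m)))

    H-recurrence : conv₂ 1# 0# (- 1#) H ≗ conv₂ t 1# t F
    H-recurrence 0 = *-identityˡ _
    H-recurrence 1 = solve 1 (λ t →
      con 1 :* (:suc (con 0) :* (t :+ t)) :+ con 0 :* (t :* t) := t :* con 1 :+ con 1 :* t) refl t
    H-recurrence 2 = ≈-modulo 1# 2½≈1 (solve 2 (λ t h →
      con 1 :* (con 2 :* (t :* t :+ t :* t :+ h)) :+ con 0 :* (:suc (con 0) :* (t :+ t))
        :+ :- con 1 :* (t :* t)
        := t :* (t :+ t) :+ con 1 :* con 1 :+ t :* t :+ (con 2 :* h :- con 1) :* con 1) refl t ½)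
    H-recurrence (suc (suc (suc m))) = window m (num m)
      where
      -- x stands for num m; abstracting it makes the identity periodic in m.
      window : ∀ m x →
        1# * ((1# + (1# + (1# + x))) * period₂ (t + t) b-even (2 ℕ.+ m))
          + 0# * ((1# + (1# + x)) * period₂ (t + t) b-even (1 ℕ.+ m))
          + - 1# * ((1# + x) * period₂ (t + t) b-even m)
        ≈ t * F (3 ℕ.+ m) + 1# * F (2 ℕ.+ m) + t * F (1 ℕ.+ m)
      window 0 x = solve 3 (λ t x h →
        con 1 :* (:suc (:suc (:suc x)) :* (t :+ t)) :+ con 0 :* (:suc (:suc x) :* (t :* t :+ t :* t :+ h))
          :+ :- con 1 :* (:suc x :* (t :+ t))
          := t :* con 1 :+ con 1 :* (t :+ t) :+ t :* con 1) refl t x ½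
      window 1 x = ≈-modulo 1# 2½≈1 (solve 3 (λ t x h →
        con 1 :* (:suc (:suc (:suc x)) :* (t :* t :+ t :* t :+ h)) :+ con 0 :* (:suc (:suc x) :* (t :+ t))
          :+ :- con 1 :* (:suc x :* (t :* t :+ t :* t :+ h))
          := t :* (t :+ t) :+ con 1 :* con 1 :+ t :* (t :+ t) :+ (con 2 :* h :- con 1) :* con 1) refl t x ½)
      window (suc (suc m)) = window m

    F-normalizedMultiplicative : NormalizedMultiplicative F
    F-normalizedMultiplicative = normalizedMultiplicative j
      (trans (solve 2 (λ t j → t :* (j :+ j) := (t :+ t) :* j) refl t j) [t+t]j≈1)
      refl
      (coprimeMultiplicative-cong (λ n → sym (F≈whenDivides n))
        (whenDivides-coprimeMultiplicative prime[2] (t + t)))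
      where
      F≈whenDivides : ∀ n → F (suc n) ≈ whenDivides 2 (t + t) (suc n)
      F≈whenDivides = periodic-≈ 2 (λ _ → refl) (λ n → whenDivides-periodic 2 _ (suc n)) agree
        where
        agree : ∀ k → k < 2 → F (suc k) ≈ whenDivides 2 (t + t) (suc k)
        agree 0 _ = refl
        agree 1 _ = refl
        agree (suc (suc _)) (s≤s (s≤s ()))

    H-multiplicative : Multiplicative H
    H-multiplicative = j , normalizedMultiplicative (j + j)
      (≈-modulo ((t + t) * j + 1#) [t+t]j≈1 (solve 2 (λ t j →
         j :* (t :* t) :* ((j :+ j) :+ (j :+ j))
           := con 1 :+ ((t :+ t) :* j :- con 1) :* ((t :+ t) :* j :+ con 1)) refl t j))
      (≈-modulo 1# [t+t]j≈1 (solve 2 (λ t j →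
         j :* (:suc (con 0) :* (t :+ t)) := con 1 :+ ((t :+ t) :* j :- con 1) :* con 1) refl t j))
      (coprimeMultiplicative-cong
        (λ n → trans (*-congˡ (sym (jb≈whenDivides n)))
                     (solve 3 (λ x j b → x :* (j :* b) := j :* (x :* b))
                            refl (num (suc n)) j (period₂ (t + t) b-even n)))
        (coprimeMultiplicative-* num-coprimeMultiplicative
          (whenDivides-coprimeMultiplicative prime[2] (j * b-even))))
      where
      jb≈whenDivides : ∀ n → j * period₂ (t + t) b-even n ≈ whenDivides 2 (j * b-even) (suc n)
      jb≈whenDivides = periodic-≈ 2 (λ _ → refl) (λ n → whenDivides-periodic 2 _ (suc n)) agree
        where
        agree : ∀ k → k < 2 → j * period₂ (t + t) b-even k ≈ whenDivides 2 (j * b-even) (suc k)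
        agree 0 _ = trans (*-comm j (t + t)) [t+t]j≈1
        agree 1 _ = refl
        agree (suc (suc _)) (s≤s (s≤s ()))

    InX-expansion : ∀ f → IsExpansion (poly (t ∷ 1# ∷ t ∷ [])) (poly (1# ∷ 0# ∷ - 1# ∷ [])) f →
                    InX f
    InX-expansion = InX-of-recurrences (*-identityʳ 1#) F-recurrence H-recurrence
                F-normalizedMultiplicative H-multiplicative

  -- f = 1/6 + Σ χ₃(n) qⁿ and f² = 1/36 + Σ (n/6) e(n) qⁿ,
  -- where e(n) is -4 if 3 ∣ n and 2 otherwise.
  module Case-xiii where
    y : Carrier
    y = proj₁ (inverse (num 6) (charZero 5))

    6y≈1 : num 6 * y ≈ 1#
    6y≈1 = proj₂ (inverse (num 6) (charZero 5))

    e : ℕ → Carrier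
    e = period₃ (- num 4) (num 2) (num 2)

    F : Series
    F zero    = y
    F (suc n) = χ₃ (suc n)

    H : Series
    H zero    = y * y
    H (suc n) = y * (num (suc n) * e (suc n))

    F-recurrence : conv₂ (num 6) (num 6) (num 6) F ≗ poly (1# ∷ num 7 ∷ 1# ∷ [])
    F-recurrence 0 = 6y≈1
    F-recurrence 1 = ≈-modulo 1# 6y≈1 (solve 1 (λ y →
      con 6 :* con 1 :+ con 6 :* y := con 7 :+ (con 6 :* y :- con 1) :* con 1) refl y)
    F-recurrence 2 = ≈-modulo 1# 6y≈1 (solve 1 (λ y →
      con 6 :* :- con 1 :+ con 6 :* con 1 :+ con 6 :* y := con 1 :+ (con 6 :* y :- con 1) :* con 1) refl y)
    F-recurrence (suc (suc (suc m))) = window m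
      where
      window : ∀ m → num 6 * χ₃ (3 ℕ.+ m) + num 6 * χ₃ (2 ℕ.+ m) + num 6 * χ₃ (1 ℕ.+ m) ≈ 0#
      window 0 = solve 0 (con 6 :* con 0 :+ con 6 :* :- con 1 :+ con 6 :* con 1 := con 0) refl
      window 1 = solve 0 (con 6 :* con 1 :+ con 6 :* con 0 :+ con 6 :* :- con 1 := con 0) refl
      window 2 = solve 0 (con 6 :* :- con 1 :+ con 6 :* con 1 :+ con 6 :* con 0 := con 0) refl
      window (suc (suc (suc m))) = window m

    H-recurrence : conv₂ (num 6) (num 6) (num 6) H ≗ conv₂ 1# (num 7) 1# F
    H-recurrence 0 = ≈-modulo y 6y≈1 (solve 1 (λ y →
      con 6 :* (y :* y) := con 1 :* y :+ (con 6 :* y :- con 1) :* y) refl y)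
    H-recurrence 1 = ≈-modulo (y + 1#) 6y≈1 (solve 1 (λ y →
      con 6 :* (y :* (:suc (con 0) :* con 2)) :+ con 6 :* (y :* y)
        := con 1 :* con 1 :+ con 7 :* y :+ (con 6 :* y :- con 1) :* (y :+ con 1)) refl y)
    H-recurrence 2 = ≈-modulo (y + num 6) 6y≈1 (solve 1 (λ y →
      con 6 :* (y :* (con 2 :* con 2)) :+ con 6 :* (y :* (:suc (con 0) :* con 2)) :+ con 6 :* (y :* y)
        := con 1 :* :- con 1 :+ con 7 :* con 1 :+ con 1 :* y :+ (con 6 :* y :- con 1) :* (y :+ con 6)) refl y)
    H-recurrence (suc (suc (suc m))) = window m (num m)
      where
      window : ∀ m x →
        num 6 * (y * ((1# + (1# + (1# + x))) * e (3 ℕ.+ m)))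
          + num 6 * (y * ((1# + (1# + x)) * e (2 ℕ.+ m)))
          + num 6 * (y * ((1# + x) * e (1 ℕ.+ m)))
        ≈ 1# * χ₃ (3 ℕ.+ m) + num 7 * χ₃ (2 ℕ.+ m) + 1# * χ₃ (1 ℕ.+ m)
      window 0 x = ≈-modulo (- num 6) 6y≈1 (solve 2 (λ y x →
        con 6 :* (y :* (:suc (:suc (:suc x)) :* :- con 4)) :+ con 6 :* (y :* (:suc (:suc x) :* con 2))
          :+ con 6 :* (y :* (:suc x :* con 2))
          := con 1 :* con 0 :+ con 7 :* :- con 1 :+ con 1 :* con 1 :+ (con 6 :* y :- con 1) :* :- con 6)
        refl y x)
      window 1 x = ≈-modulo 0# 6y≈1 (solve 2 (λ y x →
        con 6 :* (y :* (:suc (:suc (:suc x)) :* con 2)) :+ con 6 :* (y :* (:suc (:suc x) :* :- con 4))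
          :+ con 6 :* (y :* (:suc x :* con 2))
          := con 1 :* con 1 :+ con 7 :* con 0 :+ con 1 :* :- con 1 :+ (con 6 :* y :- con 1) :* con 0) refl y x)
      window 2 x = ≈-modulo (num 6) 6y≈1 (solve 2 (λ y x →
        con 6 :* (y :* (:suc (:suc (:suc x)) :* con 2)) :+ con 6 :* (y :* (:suc (:suc x) :* con 2))
          :+ con 6 :* (y :* (:suc x :* :- con 4))
          := con 1 :* :- con 1 :+ con 7 :* con 1 :+ con 1 :* con 0 :+ (con 6 :* y :- con 1) :* con 6) refl y x)
      window (suc (suc (suc m))) = window m

    F-normalizedMultiplicative : NormalizedMultiplicative F
    F-normalizedMultiplicative = normalizedMultiplicative {F} (num 3)
      (≈-modulo 1# 6y≈1 (solve 1 (λ y →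
         y :* (con 3 :+ con 3) := con 1 :+ (con 6 :* y :- con 1) :* con 1) refl y))
      refl
      (coprimeMultiplicative-cong (λ _ → refl) (λ m n _ _ _ → χ₃-* m n))

    3ye≈whenDivides : ∀ n → num 3 * (y * e n) ≈ whenDivides 3 (- num 2) n
    3ye≈whenDivides = periodic-≈ 3 (λ _ → refl) (whenDivides-periodic 3 _) agree
      where
      3y*2≈1 : num 3 * (y * num 2) ≈ 1#
      3y*2≈1 = ≈-modulo 1# 6y≈1 (solve 1 (λ y →
        con 3 :* (y :* con 2) := con 1 :+ (con 6 :* y :- con 1) :* con 1) refl y)
      agree : ∀ k → k < 3 → num 3 * (y * e k) ≈ whenDivides 3 (- num 2) k
      agree 0 _ = ≈-modulo (- num 2) 6y≈1 (solve 1 (λ y →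
        con 3 :* (y :* :- con 4) := :- con 2 :+ (con 6 :* y :- con 1) :* :- con 2) refl y)
      agree 1 _ = 3y*2≈1
      agree 2 _ = 3y*2≈1
      agree (suc (suc (suc _))) (s≤s (s≤s (s≤s ())))

    H-multiplicative : Multiplicative H
    H-multiplicative = num 3 , normalizedMultiplicative (num 6)
      (≈-modulo (num 6 * y + 1#) 6y≈1 (solve 1 (λ y →
         con 3 :* (y :* y) :* (con 6 :+ con 6)
           := con 1 :+ (con 6 :* y :- con 1) :* (con 6 :* y :+ con 1)) refl y))
      (≈-modulo 1# 6y≈1 (solve 1 (λ y →
         con 3 :* (y :* (:suc (con 0) :* con 2)) := con 1 :+ (con 6 :* y :- con 1) :* con 1) refl y))
      (coprimeMultiplicative-cong
        (λ n → trans (*-congˡ (sym (3ye≈whenDivides (suc n))))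
                     (solve 4 (λ x t y e → x :* (t :* (y :* e)) := t :* (y :* (x :* e)))
                            refl (num (suc n)) (num 3) y (e (suc n))))
        (coprimeMultiplicative-* num-coprimeMultiplicative
          (whenDivides-coprimeMultiplicative prime[3] (- num 2))))
      where
      prime[3] : Prime 3
      prime[3] = from-yes (prime? 3)

    InX-expansion : ∀ f → IsExpansion (poly (1# ∷ num 7 ∷ 1# ∷ [])) (poly (num 6 ∷ num 6 ∷ num 6 ∷ [])) f →
                    InX f
    InX-expansion = InX-of-recurrences 6y≈1 F-recurrence H-recurrence
                      F-normalizedMultiplicative H-multiplicative

  -- f = 1/12 + Σ n qⁿ and f² = 1/144 + Σ (n³/6) qⁿ.
  module Case-xiv where
    y : Carrier
    y = proj₁ (inverse (num 12) (charZero 11))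

    12y≈1 : num 12 * y ≈ 1#
    12y≈1 = proj₂ (inverse (num 12) (charZero 11))

    F : Series
    F zero    = y
    F (suc n) = num (suc n)

    H : Series
    H zero    = y * y
    H (suc n) = y * (num 2 * (num (suc n) * num (suc n) * num (suc n)))

    F-recurrence : conv₂ (num 12) (- num 24) (num 12) F ≗ poly (1# ∷ num 10 ∷ 1# ∷ [])
    F-recurrence 0 = 12y≈1
    F-recurrence 1 = ≈-modulo (- num 2) 12y≈1 (solve 1 (λ y →
      con 12 :* :suc (con 0) :+ :- con 24 :* y
        := con 10 :+ (con 12 :* y :- con 1) :* :- con 2) refl y)
    F-recurrence 2 = ≈-modulo 1# 12y≈1 (solve 1 (λ y →
      con 12 :* con 2 :+ :- con 24 :* :suc (con 0) :+ con 12 :* y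
        := con 1 :+ (con 12 :* y :- con 1) :* con 1) refl y)
    F-recurrence (suc (suc (suc m))) = solve 1 (λ x →
      con 12 :* :suc (:suc (:suc x)) :+ :- con 24 :* :suc (:suc x) :+ con 12 :* :suc x := con 0)
      refl (num m)

    H-recurrence : conv₂ (num 12) (- num 24) (num 12) H ≗ conv₂ 1# (num 10) 1# F
    H-recurrence 0 = ≈-modulo y 12y≈1 (solve 1 (λ y →
      con 12 :* (y :* y) := con 1 :* y :+ (con 12 :* y :- con 1) :* y) refl y)
    H-recurrence 1 = ≈-modulo (1# - num 2 * y) 12y≈1 (solve 1 (λ y →
      con 12 :* (y :* (con 2 :* (:suc (con 0) :* :suc (con 0) :* :suc (con 0))))
        :+ :- con 24 :* (y :* y)
        := con 1 :* :suc (con 0) :+ con 10 :* y :+ (con 12 :* y :- con 1) :* (con 1 :- con 2 :* y))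
      refl y)
    H-recurrence 2 = ≈-modulo (y + num 12) 12y≈1 (solve 1 (λ y →
      con 12 :* (y :* (con 2 :* (con 2 :* con 2 :* con 2)))
        :+ :- con 24 :* (y :* (con 2 :* (:suc (con 0) :* :suc (con 0) :* :suc (con 0))))
        :+ con 12 :* (y :* y)
        := con 1 :* con 2 :+ con 10 :* :suc (con 0) :+ con 1 :* y
           :+ (con 12 :* y :- con 1) :* (y :+ con 12)) refl y)
    H-recurrence (suc (suc (suc m))) = ≈-modulo (num 12 * num m + num 24) 12y≈1 (solve 2 (λ y x →
      con 12 :* (y :* (con 2 :* (:suc (:suc (:suc x)) :* :suc (:suc (:suc x)) :* :suc (:suc (:suc x)))))
        :+ :- con 24 :* (y :* (con 2 :* (:suc (:suc x) :* :suc (:suc x) :* :suc (:suc x))))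
        :+ con 12 :* (y :* (con 2 :* (:suc x :* :suc x :* :suc x)))
        := con 1 :* :suc (:suc (:suc x)) :+ con 10 :* :suc (:suc x) :+ con 1 :* :suc x
           :+ (con 12 :* y :- con 1) :* (con 12 :* x :+ con 24)) refl y (num m))

    F-normalizedMultiplicative : NormalizedMultiplicative F
    F-normalizedMultiplicative = normalizedMultiplicative (num 6)
      (≈-modulo 1# 12y≈1 (solve 1 (λ y →
         y :* (con 6 :+ con 6) := con 1 :+ (con 12 :* y :- con 1) :* con 1) refl y))
      (+-identityʳ 1#)
      (coprimeMultiplicative-cong (λ _ → refl) num-coprimeMultiplicative)

    H-multiplicative : Multiplicative H
    H-multiplicative = num 6 , normalizedMultiplicative (num 12)
      (≈-modulo (num 12 * y + 1#) 12y≈1 (solve 1 (λ y →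
         con 6 :* (y :* y) :* (con 12 :+ con 12)
           := con 1 :+ (con 12 :* y :- con 1) :* (con 12 :* y :+ con 1)) refl y))
      (≈-modulo 1# 12y≈1 (solve 1 (λ y →
         con 6 :* (y :* (con 2 :* (:suc (con 0) :* :suc (con 0) :* :suc (con 0))))
           := con 1 :+ (con 12 :* y :- con 1) :* con 1) refl y))
      (coprimeMultiplicative-cong (λ n → sym (6H≈cube (num (suc n))))
        (coprimeMultiplicative-* num-coprimeMultiplicative
          (coprimeMultiplicative-* num-coprimeMultiplicative num-coprimeMultiplicative)))
      where
      6H≈cube : ∀ x → num 6 * (y * (num 2 * (x * x * x))) ≈ x * (x * x)
      6H≈cube x = ≈-modulo (x * x * x) 12y≈1 (solve 2 (λ y x →
        con 6 :* (y :* (con 2 :* (x :* x :* x))) := x :* (x :* x) :+ (con 12 :* y :- con 1) :* (x :* x :* x))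
        refl y x)

    InX-expansion : ∀ f → IsExpansion (poly (1# ∷ num 10 ∷ 1# ∷ []))
                                      (poly (num 12 ∷ - num 24 ∷ num 12 ∷ [])) f → InX f
    InX-expansion = InX-of-recurrences 12y≈1 F-recurrence H-recurrence
                      F-normalizedMultiplicative H-multiplicative

  InX-xii : ∀ t → ¬ t ≈ 0# → ∀ f₁ f₂ →
            IsExpansion (poly (1# ∷ 0# ∷ 1# ∷ [])) (poly (1# ∷ 0# ∷ - 1# ∷ [])) f₁ →
            IsExpansion (poly (0# ∷ 1# ∷ [])) (poly (1# ∷ 0# ∷ - 1# ∷ [])) f₂ →
            InX (t ·ₛ f₁ ⊕ f₂)
  InX-xii t t≉0 f₁ f₂ f₁-exp f₂-exp = Case-xii.InX-expansion t t≉0 (t ·ₛ f₁ ⊕ f₂)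
    (IsExpansion-cong (t ·ₛ f₁ ⊕ f₂) numerator ≗-refl (IsExpansion-⊕ t f₁ f₂ f₁-exp f₂-exp))
    where
    numerator : t ·ₛ poly (1# ∷ 0# ∷ 1# ∷ []) ⊕ poly (0# ∷ 1# ∷ []) ≗ poly (t ∷ 1# ∷ t ∷ [])
    numerator 0 = solve 1 (λ t → t :* con 1 :+ con 0 := t) refl t
    numerator 1 = solve 1 (λ t → t :* con 0 :+ con 1 := con 1) refl t
    numerator 2 = solve 1 (λ t → t :* con 1 :+ con 0 := t) refl t
    numerator (suc (suc (suc _))) = solve 1 (λ t → t :* con 0 :+ con 0 := con 0) refl t

  InX-xiii : ∀ f → IsExpansion (poly (1# ∷ num 7 ∷ 1# ∷ [])) (poly (num 6 ∷ num 6 ∷ num 6 ∷ [])) f →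
             InX f
  InX-xiii = Case-xiii.InX-expansion

  InX-xiii′ : ∀ f → IsExpansion (poly (- 1# ∷ num 7 ∷ - 1# ∷ [])) (poly (num 6 ∷ - num 6 ∷ num 6 ∷ [])) f →
              InX f
  InX-xiii′ = InX-of-twisted InX-xiii
    (twist-poly₂ 1# _ 1#)
    (λ n → trans (alt-poly₂ _ _ _ n) (poly-cong (refl ∷ ⁻¹-involutive (num 6) ∷ refl ∷ []) n))

  InX-xiv : ∀ f → IsExpansion (poly (1# ∷ num 10 ∷ 1# ∷ []))
                              (num 12 ·ₛ (poly (- 1# ∷ 1# ∷ []) ⊛ poly (- 1# ∷ 1# ∷ []))) f → InX f
  InX-xiv f f-exp = Case-xiv.InX-expansion f (IsExpansion-cong f ≗-refl denominator f-exp)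
    where
    denominator : num 12 ·ₛ (poly (- 1# ∷ 1# ∷ []) ⊛ poly (- 1# ∷ 1# ∷ [])) ≗
                  poly (num 12 ∷ - num 24 ∷ num 12 ∷ [])
    denominator n = trans (scaled-square _ _ _ n) (poly-cong
      ( solve 0 (con 12 :* (:- con 1 :* :- con 1) := con 12) refl
      ∷ solve 0 (con 12 :* (:- con 1 :* con 1 :+ con 1 :* :- con 1) := :- con 24) refl
      ∷ solve 0 (con 12 :* (con 1 :* con 1) := con 12) refl
      ∷ []) n)

  InX-xiv′ : ∀ f → IsExpansion (poly (- 1# ∷ num 10 ∷ - 1# ∷ []))
                               (num 12 ·ₛ (poly (1# ∷ 1# ∷ []) ⊛ poly (1# ∷ 1# ∷ []))) f → InX f
  InX-xiv′ f f-exp = InX-of-twisted Case-xiv.InX-expansion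
    (twist-poly₂ 1# _ 1#)
    (alt-poly₂ _ _ _)
    f (IsExpansion-cong f ≗-refl denominator f-exp)
    where
    denominator : num 12 ·ₛ (poly (1# ∷ 1# ∷ []) ⊛ poly (1# ∷ 1# ∷ [])) ≗
                  poly (num 12 ∷ num 24 ∷ num 12 ∷ [])
    denominator n = trans (scaled-square _ _ _ n) (poly-cong
      ( solve 0 (con 12 :* (con 1 :* con 1) := con 12) refl
      ∷ solve 0 (con 12 :* (con 1 :* con 1 :+ con 1 :* con 1) := con 24) refl
      ∷ solve 0 (con 12 :* (con 1 :* con 1) := con 12) refl
      ∷ []) n)

proposition3p5 : ∀ {c ℓ} (F : CharZeroField c ℓ) →
  let open CharZeroField F
      open PowerSeries F
  in
  -- (xii)  t(1+q²)/(1-q²) + q/(1-q²), t ≠ 0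
  (∀ t → ¬ (t ≈ 0#) → ∀ f₁ f₂ →
    IsExpansion (poly (1# ∷ 0# ∷ 1# ∷ [])) (poly (1# ∷ 0# ∷ - 1# ∷ [])) f₁ →
    IsExpansion (poly (0# ∷ 1# ∷ [])) (poly (1# ∷ 0# ∷ - 1# ∷ [])) f₂ →
    InX (λ n → t * f₁ n + f₂ n))
  -- (xiii)  (q²+7q+1)/(6q²+6q+6)
  × (∀ f → IsExpansion (poly (1# ∷ num 7 ∷ 1# ∷ []))
                       (poly (num 6 ∷ num 6 ∷ num 6 ∷ [])) f → InX f)
  -- (xiii')  (-q²+7q-1)/(6q²-6q+6)
  × (∀ f → IsExpansion (poly (- 1# ∷ num 7 ∷ - 1# ∷ []))
                       (poly (num 6 ∷ - num 6 ∷ num 6 ∷ [])) f → InX f)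
  -- (xiv)  (q²+10q+1)/(12(q-1)²)
  × (∀ f → IsExpansion (poly (1# ∷ num 10 ∷ 1# ∷ []))
                       (num 12 ·ₛ (poly (- 1# ∷ 1# ∷ []) ⊛ poly (- 1# ∷ 1# ∷ []))) f → InX f)
  -- (xiv')  (-q²+10q-1)/(12(q+1)²)
  × (∀ f → IsExpansion (poly (- 1# ∷ num 10 ∷ - 1# ∷ []))
                       (num 12 ·ₛ (poly (1# ∷ 1# ∷ []) ⊛ poly (1# ∷ 1# ∷ []))) f → InX f)
proposition3p5 F = InX-xii , InX-xiii , InX-xiii′ , InX-xiv , InX-xiv′
  where open Expansions F
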